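{- Let $T$ be a tree of order $n$ with $\operatorname{diam}(T)\geq 3$. Then $$n-\beta(T)\;\leq\;\gamma_{t,coi}(T)\;\leq\; n-|L(T)|.$$
   Context: All graphs are finite, simple and undirected. For a graph $G$, a set $D\subseteq V(G)$ is a total dominating set if every vertex of $G$ (including those in $D$) has at least one neighbor in $D$. A total dominating set $D$ is a total co-independent dominating set if $V(G)\setminus D$ is nonempty and independent (no two of its vertices are adjacent). $\gamma_{t,coi}(G)$ denotes the minimum cardinality of a total co-independent dominating set of $G$. $\beta(G)$ is the independence number (maximum size of an independent set). For a tree $T$, a leaf is a vertex of degree one and $L(T)$ is the set of leaves of $T$. -}

module Defs where

open import Data.Nat using (ℕ; zero; suc; _≤_; _+_)
open import Data.Bool using (Bool; true; false)
open import Data.Fin using (Fin)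
open import Data.Fin.Subset using (Subset; _∈_; _∉_; ∣_∣)
open import Data.Vec using (tabulate)
open import Data.List using (List; []; _∷_; _∷ʳ_; length)
open import Data.List.Relation.Unary.Linked using (Linked)
open import Data.List.Relation.Unary.Unique.Propositional using (Unique)
open import Data.Product using (Σ; ∃; _×_)
open import Relation.Binary.PropositionalEquality using (_≡_)
open import Relation.Nullary using (¬_)

record Graph (n : ℕ) : Set where
  field
    adj    : Fin n → Fin n → Bool
    sym    : ∀ u v → adj u v ≡ adj v u
    irrefl : ∀ v → adj v v ≡ false

module _ {n : ℕ} (G : Graph n) where
  open Graph G

  Adj : Fin n → Fin n → Set
  Adj u v = adj u v ≡ true

  data Walk : Fin n → Fin n → ℕ → Set where
    [] : ∀ {v} → Walk v v zero
    _∷_ : ∀ {u v w k} → Adj u v → Walk v w k → Walk u w (suc k)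

  Connected : Set
  Connected = ∀ u v → ∃ λ k → Walk u v k

  -- a cycle v ∷ ws : distinct vertices, at least 3 of them,
  -- consecutive ones adjacent and the last adjacent to v
  IsCycle : List (Fin n) → Set
  IsCycle [] = ¬ (0 ≡ 0)
  IsCycle (v ∷ ws) = (2 ≤ length ws) × Unique (v ∷ ws) × Linked Adj ((v ∷ ws) ∷ʳ v)

  Acyclic : Set
  Acyclic = ∀ cs → ¬ IsCycle cs

  IsTree : Set
  IsTree = Connected × Acyclic

  DistAtLeast : Fin n → Fin n → ℕ → Set
  DistAtLeast u v d = ∀ k → Walk u v k → d ≤ k

  DiamAtLeast : ℕ → Set
  DiamAtLeast d = ∃ λ u → ∃ λ v → DistAtLeast u v d

  degree : Fin n → ℕ
  degree v = ∣ tabulate (adj v) ∣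

  leaves : Subset n
  leaves = tabulate λ v → isOne (degree v)
    where
    isOne : ℕ → Bool
    isOne 1 = true
    isOne _ = false

  Independent : Subset n → Set
  Independent S = ∀ u v → u ∈ S → v ∈ S → ¬ Adj u v

  IsIndependenceNumber : ℕ → Set
  IsIndependenceNumber b =
    (∃ λ S → Independent S × ∣ S ∣ ≡ b) × (∀ S → Independent S → ∣ S ∣ ≤ b)

  TotalDominating : Subset n → Set
  TotalDominating D = ∀ v → ∃ λ u → u ∈ D × Adj v u

  TotalCoIndependentDominating : Subset n → Set
  TotalCoIndependentDominating D =
    TotalDominating D × (∃ λ v → v ∉ D) × (∀ u v → u ∉ D → v ∉ D → ¬ Adj u v)

  IsGammaTCoi : ℕ → Set
  IsGammaTCoi g =
    (∃ λ D → TotalCoIndependentDominating D × ∣ D ∣ ≡ g)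
    × (∀ D → TotalCoIndependentDominating D → g ≤ ∣ D ∣)

module Submission where

-- Lower bound (any graph): if D is a total co-independent dominating set,
-- then V ∖ D is independent, so n − |D| ≤ β.
--
-- Upper bound: the set V ∖ L of non-leaves is total co-independent
-- dominating.  The key observation is that when diam(T) ≥ 3 no vertex v
-- has only leaves as neighbours: otherwise, by connectivity, every vertex
-- is v or adjacent to v, and the diameter would be at most 2.  Hence every
-- vertex has a non-leaf neighbour (total domination) and no two leaves are
-- adjacent (independence of L).  Finally L is nonempty, since the end of a
-- maximal path in an acyclic graph is a leaf or an isolated vertex.
--
-- Existence of γ_{t,coi}(T) is a finite search: total co-independent
-- domination is decidable, and a decidable property of subsets of a finite
-- set that has a witness has a witness of minimum cardinality.

open import Defs
open import Data.Nat using (ℕ; _≤_; _∸_)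
open import Data.Fin.Subset using (∣_∣)
open import Data.Product using (∃; _×_)

open import Data.Nat using (zero; suc; _<_; _+_; z≤n; s≤s; _≤?_)
open import Data.Nat.Properties using (≤-trans; <-irrefl; <⇒≱; ≰⇒>; +-suc; m≤m+n; m≤n+m; ∸-monoʳ-≤; m∸[m∸n]≡n)
open import Data.Bool using (Bool; true; false) renaming (_≟_ to _≟ᵇ_)
open import Data.Fin using (Fin) renaming (_<_ to _<ᶠ_; _≟_ to _≟ᶠ_)
open import Data.Fin.Properties using (any?; all?; pigeonhole)
open import Data.Fin.Subset using (Subset; _∈_; _∉_; _⊂_; ⁅_⁆; ∁)
open import Data.Fin.Subset.Properties
  using (_∈?_; anySubset?; ∣p∣≤n; ⊆-antisym; x∈⁅x⁆; p⊂q⇒∣p∣<∣q∣; x∈⁅y⁆⇒x≡y; x≢y⇒x∉⁅y⁆; ∣⁅x⁆∣≡1;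
         x∈p⇒x∉∁p; x∈∁p⇒x∉p; x∉∁p⇒x∈p; x∉p⇒x∈∁p; ∣∁p∣≡n∸∣p∣)
open import Data.Vec using (tabulate; lookup)
open import Data.Vec.Properties using (lookup∘tabulate; lookup⇒[]=; []=⇒lookup)
open import Data.List using (List; []; _∷_; _++_; [_]; _∷ʳ_; length)
import Data.List as List
open import Data.List.Properties using (++-assoc; length-++)
open import Data.List.Relation.Unary.Linked using (Linked; []; [-]; _∷_)
open import Data.List.Relation.Unary.AllPairs using ([]; _∷_)
open import Data.List.Relation.Unary.All using ([])
import Data.List.Relation.Unary.All.Properties as All
open import Data.List.Relation.Unary.All.Properties.Core using (All¬⇒¬Any; ¬Any⇒All¬)
open import Data.List.Relation.Unary.Any using (here; there)
open import Data.List.Relation.Unary.Unique.Propositional using (Unique)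
import Data.List.Membership.Propositional as Membership
open import Data.List.Membership.DecPropositional using () renaming (_∈?_ to member?)
open import Data.List.Membership.Propositional.Properties using (∈-lookup; ∈-∃++)
open import Data.Product using (_,_; proj₂)
open import Data.Sum using (_⊎_; inj₁; inj₂)
open import Function using (_∘_)
open import Relation.Nullary using (¬_; yes; no; contradiction)
open import Relation.Nullary.Decidable using (_×-dec_; ¬?; _→-dec_)
open import Relation.Unary using (Decidable)
open import Relation.Binary.PropositionalEquality using (_≡_; _≢_; refl; sym; trans; cong; subst)

∈-tabulate⁺ : ∀ {m} (f : Fin m → Bool) {x} → f x ≡ true → x ∈ tabulate f
∈-tabulate⁺ f {x} fx = lookup⇒[]= x (tabulate f) (trans (lookup∘tabulate f x) fx)

∈-tabulate⁻ : ∀ {m} (f : Fin m → Bool) {x} → x ∈ tabulate f → f x ≡ true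
∈-tabulate⁻ f {x} x∈f = trans (sym (lookup∘tabulate f x)) ([]=⇒lookup x∈f)

-- A subset of cardinality one has at most one element: two distinct
-- elements x, y would make ⁅ x ⁆ a proper subset.
∣p∣≡1⇒unique : ∀ {m} {p : Subset m} {x y} → ∣ p ∣ ≡ 1 → x ∈ p → y ∈ p → x ≡ y
∣p∣≡1⇒unique {p = p} {x} {y} ∣p∣≡1 x∈p y∈p with x ≟ᶠ y
... | yes x≡y = x≡y
... | no x≢y = contradiction (p⊂q⇒∣p∣<∣q∣ ⁅x⁆⊂p) (<-irrefl (trans (∣⁅x⁆∣≡1 x) (sym ∣p∣≡1)))
  where
  ⁅x⁆⊂p : ⁅ x ⁆ ⊂ p
  ⁅x⁆⊂p = (λ z∈⁅x⁆ → subst (_∈ p) (sym (x∈⁅y⁆⇒x≡y x z∈⁅x⁆)) x∈p)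
        , y , y∈p , x≢y⇒x∉⁅y⁆ (x≢y ∘ sym)

minimum-subset : ∀ {m} {P : Subset m → Set} → Decidable P → ∃ P →
                 ∃ λ D → P D × (∀ D′ → P D′ → ∣ D ∣ ≤ ∣ D′ ∣)
minimum-subset {m} {P} P? (D , PD) = descend m D PD (∣p∣≤n D)
  where
  descend : ∀ k D → P D → ∣ D ∣ ≤ k → ∃ λ D → P D × (∀ D′ → P D′ → ∣ D ∣ ≤ ∣ D′ ∣)
  descend zero D PD ∣D∣≤0 = D , PD , λ _ _ → ≤-trans ∣D∣≤0 z≤n
  descend (suc k) D PD ∣D∣≤1+k with anySubset? (λ D′ → P? D′ ×-dec (∣ D′ ∣ ≤? k))
  ... | yes (D′ , PD′ , ∣D′∣≤k) = descend k D′ PD′ ∣D′∣≤k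
  ... | no none = D , PD , λ D′ PD′ → ≤-trans ∣D∣≤1+k (≰⇒> (λ ∣D′∣≤k → none (D′ , PD′ , ∣D′∣≤k)))

unique⇒lookup-injective : ∀ {A : Set} {xs : List A} → Unique xs →
                          ∀ {i j} → i <ᶠ j → List.lookup xs i ≢ List.lookup xs j
unique⇒lookup-injective {xs = x ∷ xs} (x∉xs ∷ _) {Fin.zero} {Fin.suc j} _ x≡xsⱼ =
  All¬⇒¬Any x∉xs (subst (Membership._∈ xs) (sym x≡xsⱼ) (∈-lookup j))
unique⇒lookup-injective {xs = x ∷ xs} (_ ∷ u) {Fin.suc i} {Fin.suc j} (s≤s i<j) =
  unique⇒lookup-injective u i<j

unique⇒length≤ : ∀ {m} (xs : List (Fin m)) → Unique xs → length xs ≤ m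
unique⇒length≤ {m} xs u with length xs ≤? m
... | yes ≤m = ≤m
... | no ≰m with pigeonhole (≰⇒> ≰m) (List.lookup xs)
... | i , j , i<j , same = contradiction same (unique⇒lookup-injective u i<j)

Unique-++⁻ˡ : ∀ {A : Set} (xs : List A) {ys} → Unique (xs ++ ys) → Unique xs
Unique-++⁻ˡ [] _ = []
Unique-++⁻ˡ (x ∷ xs) (x∉ ∷ u) = All.++⁻ˡ xs x∉ ∷ Unique-++⁻ˡ xs u

Linked-++⁻ˡ : ∀ {A : Set} {R : A → A → Set} (xs : List A) {ys} → Linked R (xs ++ ys) → Linked R xs
Linked-++⁻ˡ [] _ = []
Linked-++⁻ˡ (x ∷ []) _ = [-]
Linked-++⁻ˡ (x ∷ x′ ∷ xs) (r ∷ l) = r ∷ Linked-++⁻ˡ (x′ ∷ xs) l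

Linked-∷ʳ⁺ : ∀ {A : Set} {R : A → A → Set} (xs : List A) {y z} →
             Linked R (xs ∷ʳ y) → R y z → Linked R (xs ∷ʳ y ∷ʳ z)
Linked-∷ʳ⁺ [] _ r = r ∷ [-]
Linked-∷ʳ⁺ (x ∷ []) (r′ ∷ _) r = r′ ∷ r ∷ [-]
Linked-∷ʳ⁺ (x ∷ x′ ∷ xs) (r′ ∷ l) r = r′ ∷ Linked-∷ʳ⁺ (x′ ∷ xs) l r

module _ {n : ℕ} (G : Graph n) where
  open Graph G using (adj; irrefl)

  Adj-sym : ∀ {u v} → Adj G u v → Adj G v u
  Adj-sym {u} {v} uv = trans (Graph.sym G v u) uv

  Adj-irrefl : ∀ {v} → ¬ Adj G v v
  Adj-irrefl {v} vv with trans (sym vv) (irrefl v)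
  ... | ()

  leaf⇒degree≡1 : ∀ {v} → v ∈ leaves G → degree G v ≡ 1
  leaf⇒degree≡1 {v} v∈L with degree G v | ∈-tabulate⁻ _ v∈L
  ... | 1 | _ = refl
  ... | 0 | ()
  ... | suc (suc _) | ()

  degree≡1⇒leaf : ∀ {v} → degree G v ≡ 1 → v ∈ leaves G
  degree≡1⇒leaf {v} deg≡1 with lookup (leaves G) v in flag
  ... | true = lookup⇒[]= v (leaves G) flag
  ... | false with degree G v | deg≡1 | trans (sym (lookup∘tabulate _ v)) flag
  ...   | .1 | refl | ()

  leaf-neighbour-unique : ∀ {a x y} → a ∈ leaves G → Adj G a x → Adj G a y → x ≡ y
  leaf-neighbour-unique {a} a∈L ax ay =
    ∣p∣≡1⇒unique (leaf⇒degree≡1 a∈L) (∈-tabulate⁺ (adj a) ax) (∈-tabulate⁺ (adj a) ay)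

  single-neighbour⇒leaf : ∀ {w p} → Adj G w p → (∀ y → Adj G w y → y ≡ p) → w ∈ leaves G
  single-neighbour⇒leaf {w} {p} wp only-p = degree≡1⇒leaf (trans (cong ∣_∣ N[w]≡⁅p⁆) (∣⁅x⁆∣≡1 p))
    where
    N[w]≡⁅p⁆ : tabulate (adj w) ≡ ⁅ p ⁆
    N[w]≡⁅p⁆ = ⊆-antisym
      (λ {x} x∈N → subst (_∈ ⁅ p ⁆) (sym (only-p x (∈-tabulate⁻ (adj w) x∈N))) (x∈⁅x⁆ p))
      (λ {x} x∈⁅p⁆ → ∈-tabulate⁺ (adj w) (subst (Adj G w) (sym (x∈⁅y⁆⇒x≡y p x∈⁅p⁆)) wp))

  _∈N[_] : Fin n → Fin n → Set
  x ∈N[ v ] = x ≡ v ⊎ Adj G v x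

  walk-stays-in-N : ∀ {v x y k} → (∀ a → Adj G v a → a ∈ leaves G) →
                    Walk G x y k → x ∈N[ v ] → y ∈N[ v ]
  walk-stays-in-N leafy [] x∈N = x∈N
  walk-stays-in-N leafy (xz ∷ w) (inj₁ refl) = walk-stays-in-N leafy w (inj₂ xz)
  walk-stays-in-N leafy (xz ∷ w) (inj₂ vx) =
    walk-stays-in-N leafy w (inj₁ (leaf-neighbour-unique (leafy _ vx) xz (Adj-sym vx)))

  N-walk : ∀ {v x y} → x ∈N[ v ] → y ∈N[ v ] → ∃ λ k → k ≤ 2 × Walk G x y k
  N-walk (inj₁ refl) (inj₁ refl) = 0 , z≤n , []
  N-walk (inj₁ refl) (inj₂ vy) = 1 , s≤s z≤n , vy ∷ []
  N-walk (inj₂ vx) (inj₁ refl) = 1 , s≤s z≤n , Adj-sym vx ∷ []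
  N-walk (inj₂ vx) (inj₂ vy) = 2 , s≤s (s≤s z≤n) , Adj-sym vx ∷ vy ∷ []

  no-leaf-star : Connected G → DiamAtLeast G 3 → ∀ v → ¬ (∀ a → Adj G v a → a ∈ leaves G)
  no-leaf-star connected (u , w , far) v leafy =
    let (k , k≤2 , walk) = N-walk (near u) (near w) in <⇒≱ (s≤s k≤2) (far k walk)
    where
    near : ∀ x → x ∈N[ v ]
    near x = walk-stays-in-N leafy (proj₂ (connected v x)) (inj₁ refl)

  non-leaf-neighbour : Connected G → DiamAtLeast G 3 → ∀ v → ∃ λ u → u ∉ leaves G × Adj G v u
  non-leaf-neighbour connected diam v
    with any? (λ u → ¬? (u ∈? leaves G) ×-dec (adj v u ≟ᵇ true))
  ... | yes found = found
  ... | no none = contradiction leafy (no-leaf-star connected diam v)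
    where
    leafy : ∀ a → Adj G v a → a ∈ leaves G
    leafy a va with a ∈? leaves G
    ... | yes a∈L = a∈L
    ... | no a∉L = contradiction (a , a∉L , va) none

  -- ... and the leaves form an independent set: the unique neighbour of a
  -- leaf adjacent to another leaf would have only leaf neighbours.
  leaves-independent : Connected G → DiamAtLeast G 3 → Independent G (leaves G)
  leaves-independent connected diam u v u∈L v∈L uv =
    no-leaf-star connected diam u
      (λ a ua → subst (_∈ leaves G) (leaf-neighbour-unique u∈L uv ua) v∈L)

  -- A path listed from its current end: distinct vertices, consecutive ones
  -- adjacent.  It is maximal when every neighbour of the end lies on it.
  record MaximalPath : Set where
    field
      end      : Fin n
      trail    : List (Fin n)
      distinct : Unique (end ∷ trail)
      linked   : Linked (Adj G) (end ∷ trail)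
      closed   : ∀ y → Adj G end y → y Membership.∈ (end ∷ trail)

  -- Every path extends to a maximal one: extend at the end while possible.
  -- Invariant n < fuel + |path|; fuel cannot run out, since by pigeonhole a
  -- path has at most n vertices.
  extend : ∀ fuel w trail → n < fuel + length (w ∷ trail) →
           Unique (w ∷ trail) → Linked (Adj G) (w ∷ trail) → MaximalPath
  extend zero w trail long distinct _ =
    contradiction (unique⇒length≤ (w ∷ trail) distinct) (<⇒≱ long)
  extend (suc fuel) w trail long distinct linked
    with any? (λ y → (adj w y ≟ᵇ true) ×-dec ¬? (member? _≟ᶠ_ y (w ∷ trail)))
  ... | yes (y , wy , y∉) =
    extend fuel y (w ∷ trail) (subst (n <_) (sym (+-suc fuel _)) long)
           (¬Any⇒All¬ _ y∉ ∷ distinct) (Adj-sym wy ∷ linked)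
  ... | no stuck =
    record { end = w ; trail = trail ; distinct = distinct ; linked = linked ; closed = closed }
    where
    closed : ∀ y → Adj G w y → y Membership.∈ (w ∷ trail)
    closed y wy with member? _≟ᶠ_ y (w ∷ trail)
    ... | yes y∈ = y∈
    ... | no y∉ = contradiction (y , wy , y∉) stuck

  -- In an acyclic graph the end w of a path w, p, … is adjacent to no later
  -- vertex y: the segment from w to y together with the edge yw is a cycle.
  no-chord : Acyclic G → ∀ {w p trail y} → Unique (w ∷ p ∷ trail) →
             Linked (Adj G) (w ∷ p ∷ trail) → Adj G w y → ¬ y Membership.∈ trail
  no-chord acyclic {w} {p} {y = y} distinct linked wy y∈trail with ∈-∃++ y∈trail
  ... | as , bs , refl = acyclic (w ∷ segment) (long , distinct′ , closed-walk)
    where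
    segment : List (Fin n)
    segment = p ∷ as ∷ʳ y
    whole : (w ∷ segment) ++ bs ≡ w ∷ p ∷ as ++ y ∷ bs
    whole = ++-assoc (w ∷ p ∷ as) [ y ] bs
    long : 2 ≤ length segment
    long = s≤s (subst (1 ≤_) (sym (length-++ as)) (m≤n+m 1 (length as)))
    distinct′ : Unique (w ∷ segment)
    distinct′ = Unique-++⁻ˡ (w ∷ segment) (subst Unique (sym whole) distinct)
    closed-walk : Linked (Adj G) (w ∷ segment ∷ʳ w)
    closed-walk = Linked-∷ʳ⁺ (w ∷ p ∷ as)
      (Linked-++⁻ˡ (w ∷ segment) (subst (Linked (Adj G)) (sym whole) linked)) (Adj-sym wy)

  maximal-end : Acyclic G → (P : MaximalPath) →
                (∀ y → ¬ Adj G (MaximalPath.end P) y) ⊎ MaximalPath.end P ∈ leaves G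
  maximal-end acyclic record { end = w ; trail = [] ; closed = closed } =
    inj₁ λ { y wy → case-here (closed y wy) wy }
    where
    case-here : ∀ {y} → y Membership.∈ [ w ] → ¬ Adj G w y
    case-here (here refl) = Adj-irrefl
  maximal-end acyclic record { end = w ; trail = p ∷ trail ; distinct = distinct
                             ; linked = linked@(wp ∷ _) ; closed = closed } =
    inj₂ (single-neighbour⇒leaf wp only-p)
    where
    only-p : ∀ y → Adj G w y → y ≡ p
    only-p y wy with closed y wy
    ... | here refl = contradiction wy Adj-irrefl
    ... | there (here y≡p) = y≡p
    ... | there (there y∈trail) = contradiction y∈trail (no-chord acyclic distinct linked wy)

  tree-has-leaf : IsTree G → DiamAtLeast G 3 → ∃ λ v → v ∈ leaves G
  tree-has-leaf (connected , acyclic) diam@(u , _) =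
    end-is-leaf (maximal-end acyclic (extend (suc n) u [] (s≤s (m≤m+n n 1)) ([] ∷ []) [-]))
    where
    -- the end is not isolated, since every vertex has a non-leaf neighbour
    end-is-leaf : ∀ {w} → (∀ y → ¬ Adj G w y) ⊎ w ∈ leaves G → ∃ λ v → v ∈ leaves G
    end-is-leaf (inj₂ leaf) = _ , leaf
    end-is-leaf (inj₁ isolated) =
      let (_ , _ , adjacent) = non-leaf-neighbour connected diam _ in contradiction adjacent (isolated _)

  non-leaves-tcid : IsTree G → DiamAtLeast G 3 → TotalCoIndependentDominating G (∁ (leaves G))
  non-leaves-tcid tree@(connected , _) diam = dominating , some-leaf , leaves-indep
    where
    dominating : TotalDominating G (∁ (leaves G))
    dominating v with non-leaf-neighbour connected diam v
    ... | u , u∉L , vu = u , x∉p⇒x∈∁p u∉L , vu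
    some-leaf : ∃ λ v → v ∉ ∁ (leaves G)
    some-leaf with tree-has-leaf tree diam
    ... | v , v∈L = v , x∈p⇒x∉∁p v∈L
    leaves-indep : ∀ u v → u ∉ ∁ (leaves G) → v ∉ ∁ (leaves G) → ¬ Adj G u v
    leaves-indep u v u∉ v∉ = leaves-independent connected diam u v (x∉∁p⇒x∈p u∉) (x∉∁p⇒x∈p v∉)

  tcid? : Decidable (TotalCoIndependentDominating G)
  tcid? D =
    all? (λ v → any? (λ u → (u ∈? D) ×-dec (adj v u ≟ᵇ true)))
    ×-dec any? (λ v → ¬? (v ∈? D))
    ×-dec all? (λ u → all? (λ v → ¬? (u ∈? D) →-dec (¬? (v ∈? D) →-dec ¬? (adj u v ≟ᵇ true))))

  γ-tcoi-exists : ∃ (TotalCoIndependentDominating G) → ∃ (IsGammaTCoi G)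
  γ-tcoi-exists witness with minimum-subset tcid? witness
  ... | D , D-tcid , minimal = ∣ D ∣ , (D , D-tcid , refl) , minimal

  n∸β≤tcid : ∀ {b D} → IsIndependenceNumber G b → TotalCoIndependentDominating G D → n ∸ b ≤ ∣ D ∣
  n∸β≤tcid {b} {D} (_ , maximum) (_ , _ , co-independent) =
    subst (n ∸ b ≤_) (m∸[m∸n]≡n (∣p∣≤n D)) (∸-monoʳ-≤ n n∸∣D∣≤b)
    where
    n∸∣D∣≤b : n ∸ ∣ D ∣ ≤ b
    n∸∣D∣≤b = subst (_≤ b) (∣∁p∣≡n∸∣p∣ D)
      (maximum (∁ D) (λ u v u∈ v∈ → co-independent u v (x∈∁p⇒x∉p u∈) (x∈∁p⇒x∉p v∈)))

theorem1 : (n : ℕ) (T : Graph n) → IsTree T → DiamAtLeast T 3 →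
    (∃ λ g → IsGammaTCoi T g)
    × (∀ g b → IsGammaTCoi T g → IsIndependenceNumber T b →
         (n ∸ b ≤ g) × (g ≤ n ∸ ∣ leaves T ∣))
theorem1 n T tree diam = γ-tcoi-exists T (∁ (leaves T) , non-leaves) , bounds
  where
  non-leaves : TotalCoIndependentDominating T (∁ (leaves T))
  non-leaves = non-leaves-tcid T tree diam
  bounds : ∀ g b → IsGammaTCoi T g → IsIndependenceNumber T b →
           (n ∸ b ≤ g) × (g ≤ n ∸ ∣ leaves T ∣)
  bounds g b ((D , D-tcid , ∣D∣≡g) , minimal) β≡b =
    subst (n ∸ b ≤_) ∣D∣≡g (n∸β≤tcid T β≡b D-tcid) ,
    subst (g ≤_) (∣∁p∣≡n∸∣p∣ (leaves T)) (minimal (∁ (leaves T)) non-leaves)
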